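{- Let $G$ be a finite group with $N$ elements, let $\mathcal S_1,\dots,\mathcal S_n$ be non-empty subsets of $G$, and let $\Gamma$ be a simple graph with vertex set $\{1,\dots,n\}$ and edge set $E(\Gamma)$. Let $\mathcal R_\Gamma=\{(g_1,\dots,g_n)\in G^n : g_i\mathcal S_i\cap g_j\mathcal S_j\neq\emptyset\text{ for every }\{i,j\}\in E(\Gamma)\}$ and let $\mathcal E_\Gamma$ be the set of equivalence classes of $\mathcal R_\Gamma$ under the relation $(g_1,\dots,g_n)\sim(h_1,\dots,h_n)$ iff $g_ih_i^{ -1}=g_jh_j^{ -1}$ for every edge $\{i,j\}\in E(\Gamma)$. Then $$\sharp(\mathcal R_\Gamma)=\sharp(\mathcal E_\Gamma)\,N^{c(\Gamma)},$$ where $c(\Gamma)$ is the number of connected components of $\Gamma$. -}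

module Defs where

open import Level using (Level; _⊔_; 0ℓ)
open import Data.Nat using (ℕ)
open import Data.Fin using (Fin)
open import Data.Product using (Σ; ∃; _×_; _,_)
open import Relation.Nullary using (¬_)
open import Relation.Unary using (Pred)
open import Relation.Binary using (Rel; Setoid; IsEquivalence; Symmetric)
open import Relation.Binary.PropositionalEquality as ≡ using (_≡_)
open import Relation.Binary.Construct.Closure.ReflexiveTransitive
  using (Star; _◅◅_; reverse) renaming (ε to ★ε)
open import Function.Bundles using (Inverse)
open import Algebra.Bundles using (Group)
import Algebra.Properties.Group as GroupProps
import Relation.Binary.Reasoning.Setoid as SetoidReasoning

-- Finite cardinality: a setoid has exactly k elements (k classes) iff
-- it is in bijection (Inverse of setoids) with Fin k.

HasCard : ∀ {a ℓ} → Setoid a ℓ → ℕ → Set (a ⊔ ℓ)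
HasCard S k = Inverse S (≡.setoid (Fin k))

record SimpleGraph (n : ℕ) : Set₁ where
  field
    Adj     : Fin n → Fin n → Set
    sym     : ∀ {i j} → Adj i j → Adj j i
    irrefl  : ∀ {i} → ¬ Adj i i

module _ {n : ℕ} (Γ : SimpleGraph n) where
  open SimpleGraph Γ

  Connected : Fin n → Fin n → Set
  Connected = Star Adj

  connected-isEquivalence : IsEquivalence Connected
  connected-isEquivalence = record
    { refl  = ★ε
    ; sym   = reverse sym
    ; trans = _◅◅_
    }

  -- the setoid of vertices modulo connectivity; its classes are the
  -- connected components of Γ
  componentSetoid : Setoid 0ℓ 0ℓ
  componentSetoid = record
    { Carrier = Fin n ; _≈_ = Connected ; isEquivalence = connected-isEquivalence }

  NumComponents : ℕ → Set
  NumComponents c = HasCard componentSetoid c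

module _ {c ℓ p : Level} (G : Group c ℓ) {n : ℕ}
         (S : Fin n → Pred (Group.Carrier G) p) (Γ : SimpleGraph n) where
  open Group G
  open SimpleGraph Γ renaming (sym to Adj-sym)

  Meets : (Fin n → Carrier) → Fin n → Fin n → Set (c ⊔ ℓ ⊔ p)
  Meets g i j = Σ Carrier λ s → Σ Carrier λ t →
                  S i s × S j t × ((g i ∙ s) ≈ (g j ∙ t))

  InR : (Fin n → Carrier) → Set (c ⊔ ℓ ⊔ p)
  InR g = ∀ i j → Adj i j → Meets g i j

  RΓ : Set (c ⊔ ℓ ⊔ p)
  RΓ = Σ (Fin n → Carrier) InR

  _≋_ : Rel RΓ ℓ
  (g , _) ≋ (h , _) = ∀ i → g i ≈ h i

  RSetoid : Setoid (c ⊔ ℓ ⊔ p) ℓ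
  RSetoid = record
    { Carrier = RΓ
    ; _≈_ = _≋_
    ; isEquivalence = record
        { refl = λ _ → refl
        ; sym = λ e i → sym (e i)
        ; trans = λ e f i → trans (e i) (f i) } }

  _∼_ : Rel RΓ ℓ
  (g , _) ∼ (h , _) = ∀ i j → Adj i j → (g i ∙ h i ⁻¹) ≈ (g j ∙ h j ⁻¹)

  private
    open GroupProps G
    open SetoidReasoning setoid

    flip⁻¹ : ∀ x y → (y ∙ x ⁻¹) ≈ (x ∙ y ⁻¹) ⁻¹
    flip⁻¹ x y = begin
      y ∙ x ⁻¹          ≈⟨ ∙-congʳ (sym (⁻¹-involutive y)) ⟩
      y ⁻¹ ⁻¹ ∙ x ⁻¹    ≈⟨ sym (⁻¹-anti-homo-∙ x (y ⁻¹)) ⟩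
      (x ∙ y ⁻¹) ⁻¹     ∎

    split : ∀ x y z → (x ∙ z ⁻¹) ≈ ((x ∙ y ⁻¹) ∙ (y ∙ z ⁻¹))
    split x y z = begin
      x ∙ z ⁻¹                    ≈⟨ ∙-congʳ (sym (identityʳ x)) ⟩
      (x ∙ ε) ∙ z ⁻¹              ≈⟨ ∙-congʳ (∙-congˡ (sym (inverseˡ y))) ⟩
      (x ∙ (y ⁻¹ ∙ y)) ∙ z ⁻¹     ≈⟨ ∙-congʳ (sym (assoc x (y ⁻¹) y)) ⟩
      ((x ∙ y ⁻¹) ∙ y) ∙ z ⁻¹     ≈⟨ assoc (x ∙ y ⁻¹) y (z ⁻¹) ⟩
      (x ∙ y ⁻¹) ∙ (y ∙ z ⁻¹)     ∎

  ∼-isEquivalence : IsEquivalence _∼_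
  ∼-isEquivalence = record
    { refl  = λ {(g , _)} i j _ → trans (inverseʳ (g i)) (sym (inverseʳ (g j)))
    ; sym   = λ {(g , _)} {(h , _)} e i j a →
                trans (flip⁻¹ (g i) (h i))
                  (trans (⁻¹-cong (e i j a)) (sym (flip⁻¹ (g j) (h j))))
    ; trans = λ {(g , _)} {(h , _)} {(k , _)} e f i j a →
                trans (split (g i) (h i) (k i))
                  (trans (∙-cong (e i j a) (f i j a))
                    (sym (split (g j) (h j) (k j))))
    }

  -- E_Γ : R_Γ modulo ~, as a setoid (its elements up to ~ are the classes)
  ESetoid : Setoid (c ⊔ ℓ ⊔ p) ℓ
  ESetoid = record { Carrier = RΓ ; _≈_ = _∼_ ; isEquivalence = ∼-isEquivalence }

-- Fix a representative ρᵃ of every class a ∈ E_Γ and a root vertex in every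
-- connected component. A tuple g ∈ R_Γ with class a satisfies g ~ ρᵃ, so the
-- "offset" i ↦ gᵢ (ρᵃᵢ)⁻¹ is constant along edges, hence along paths: it is one
-- element of G per component. Conversely, multiplying ρᵃ on the left by any
-- element of G per component stays in R_Γ and in the class a. Hence
-- R_Γ ≅ E_Γ × G^c(Γ) as setoids, and cardinalities multiply.

module Submission where

open import Defs
open import Level using (Level; _⊔_)
open import Data.Nat using (ℕ; zero; suc; _*_; _^_)
open import Data.Fin using (Fin; zero; suc)
open import Data.Fin.Properties using (*↔×)
open import Data.Fin.Permutation using (↔⇒≡)
open import Data.Product using (∃; _×_; _,_; proj₁; proj₂)
open import Data.Product.Relation.Binary.Pointwise.NonDependent using (_×ₛ_; Pointwise-≡↔≡)
open import Data.Product.Function.NonDependent.Setoid using (_×-inverse_)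
open import Data.Vec.Functional using (Vector; []; _∷_; head; tail)
import Data.Vec.Functional.Relation.Binary.Equality.Setoid as VectorEquality
open import Relation.Unary using (Pred)
open import Relation.Binary using (Setoid; IsEquivalence)
open import Relation.Binary.PropositionalEquality as ≡ using (_≡_)
open import Relation.Binary.Construct.Closure.ReflexiveTransitive using (fold; _◅_; ε)
open import Function.Bundles using (Inverse)
import Function.Construct.Identity as Identity
import Function.Construct.Composition as Composition
import Function.Construct.Symmetry as Symmetry
import Function.Consequences.Setoid as Consequences
open import Algebra.Bundles using (Group)
import Algebra.Properties.Group as GroupProperties
import Relation.Binary.Reasoning.Setoid as SetoidReasoning

HasCard-unique : ∀ {a ℓ} {S : Setoid a ℓ} {m n : ℕ} → HasCard S m → HasCard S n → m ≡ n
HasCard-unique I J = ↔⇒≡ (Composition.inverse (Symmetry.inverse I) J)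

HasCard-resp-Inverse : ∀ {a b ℓ₁ ℓ₂} {S : Setoid a ℓ₁} {T : Setoid b ℓ₂} {n : ℕ} →
                       Inverse S T → HasCard T n → HasCard S n
HasCard-resp-Inverse = Composition.inverse

HasCard-Fin : ∀ n → HasCard (≡.setoid (Fin n)) n
HasCard-Fin n = Identity.inverse (≡.setoid (Fin n))

HasCard-×ₛ : ∀ {a b ℓ₁ ℓ₂} {S : Setoid a ℓ₁} {T : Setoid b ℓ₂} {m n : ℕ} →
             HasCard S m → HasCard T n → HasCard (S ×ₛ T) (m * n)
HasCard-×ₛ I J =
  Composition.inverse (I ×-inverse J) (Composition.inverse Pointwise-≡↔≡ (Symmetry.inverse *↔×))

module _ {a ℓ} (S : Setoid a ℓ) where
  open Setoid S
  open VectorEquality S using (≋-setoid)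

  []-inverse : Inverse (≋-setoid 0) (≡.setoid (Fin 1))
  []-inverse = record
    { to        = λ _ → zero
    ; from      = λ _ → []
    ; to-cong   = λ _ → ≡.refl
    ; from-cong = λ _ ()
    ; inverse   = (λ { {zero} _ → ≡.refl }) , (λ _ ())
    }

  uncons-inverse : ∀ k → Inverse (≋-setoid (suc k)) (S ×ₛ ≋-setoid k)
  uncons-inverse k = record
    { to        = λ v → head v , tail v
    ; from      = λ (x , v) → x ∷ v
    ; to-cong   = uncons-cong
    ; from-cong = cons-cong
    ; inverse   = uncons-cong , cons-cong
    }
    where
    uncons-cong : ∀ {v w : Vector Carrier (suc k)} →
                  (∀ i → v i ≈ w i) → head v ≈ head w × (∀ i → tail v i ≈ tail w i)
    uncons-cong v≋w = v≋w zero , λ i → v≋w (suc i)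

    cons-cong : ∀ {x} {v : Vector Carrier k} {w : Vector Carrier (suc k)} →
                x ≈ head w × (∀ i → v i ≈ tail w i) → ∀ i → (x ∷ v) i ≈ w i
    cons-cong (x≈y , v≋w) zero    = x≈y
    cons-cong (x≈y , v≋w) (suc i) = v≋w i

  HasCard-≋ : ∀ {m} → HasCard S m → ∀ k → HasCard (≋-setoid k) (m ^ k)
  HasCard-≋ I zero    = []-inverse
  HasCard-≋ I (suc k) = HasCard-resp-Inverse (uncons-inverse k) (HasCard-×ₛ I (HasCard-≋ I k))

module Decomposition {c ℓ p : Level} (G : Group c ℓ) {n : ℕ}
                     (S : Fin n → Pred (Group.Carrier G) p) (Γ : SimpleGraph n) where
  open Group G hiding (ε)
  open GroupProperties G using (x≈y⇒x∙y⁻¹≈ε; //-rightDividesˡ; //-rightDividesʳ)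
  open SimpleGraph Γ using (Adj)
  open VectorEquality setoid using (≋-setoid)
  open SetoidReasoning setoid

  Rₛ : Setoid (c ⊔ ℓ ⊔ p) ℓ
  Rₛ = RSetoid G S Γ
  open Setoid Rₛ using () renaming (_≈_ to _≈ᴿ_)

  EdgeConstant : (Fin n → Carrier) → Set ℓ
  EdgeConstant y = ∀ i j → Adj i j → y i ≈ y j

  edgeConstant⇒connectedConstant : ∀ {y} → EdgeConstant y →
                                   ∀ {i j} → Connected Γ i j → y i ≈ y j
  edgeConstant⇒connectedConstant {y} y-const =
    fold (λ i j → y i ≈ y j) (λ adj y≈ → trans (y-const _ _ adj) y≈) refl

  infixl 7 _⋆_ _÷_

  _⋆_ : (Fin n → Carrier) → (Fin n → Carrier) → Fin n → Carrier
  (y ⋆ g) i = y i ∙ g i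

  -- (u ∼ w) unfolds to EdgeConstant (proj₁ u ÷ proj₁ w).
  _÷_ : (Fin n → Carrier) → (Fin n → Carrier) → Fin n → Carrier
  (g ÷ h) i = g i // h i

  ⋆÷-cancel : ∀ y g i → (y ⋆ g ÷ g) i ≈ y i
  ⋆÷-cancel y g i = //-rightDividesʳ (g i) (y i)

  ÷⋆-cancel : ∀ g h i → (g ÷ h ⋆ h) i ≈ g i
  ÷⋆-cancel g h i = //-rightDividesˡ (h i) (g i)

  ⋆-preserves-InR : ∀ {y g} → EdgeConstant y → InR G S Γ g → InR G S Γ (y ⋆ g)
  ⋆-preserves-InR {y} {g} y-const g∈R i j adj with g∈R i j adj
  ... | s , t , s∈Sᵢ , t∈Sⱼ , gᵢs≈gⱼt = s , t , s∈Sᵢ , t∈Sⱼ , (begin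
    (y i ∙ g i) ∙ s  ≈⟨ assoc _ _ _ ⟩
    y i ∙ (g i ∙ s)  ≈⟨ ∙-cong (y-const i j adj) gᵢs≈gⱼt ⟩
    y j ∙ (g j ∙ t)  ≈⟨ assoc _ _ _ ⟨
    (y j ∙ g j) ∙ t  ∎)

  ⋆÷-edgeConstant : ∀ {y} g → EdgeConstant y → EdgeConstant (y ⋆ g ÷ g)
  ⋆÷-edgeConstant {y} g y-const i j adj =
    trans (⋆÷-cancel y g i) (trans (y-const i j adj) (sym (⋆÷-cancel y g j)))

  ≋⇒∼ : ∀ u w → u ≈ᴿ w → _∼_ G S Γ u w
  ≋⇒∼ _ _ u≋w i j _ = trans (x≈y⇒x∙y⁻¹≈ε (u≋w i)) (sym (x≈y⇒x∙y⁻¹≈ε (u≋w j)))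

  module _ {cΓ e : ℕ} (IC : NumComponents Γ cΓ) (IE : HasCard (ESetoid G S Γ) e) where
    private
      module IC = Inverse IC
      module IE = Inverse IE

    component : Fin n → Fin cΓ
    component = IC.to

    root : Fin cΓ → Fin n
    root = IC.from

    Eₛ : Setoid c ℓ
    Eₛ = ≡.setoid (Fin e) ×ₛ ≋-setoid cΓ
    open Setoid Eₛ using () renaming (_≈_ to _≈ᴱ_)
    open Consequences Rₛ Eₛ using (strictlyInverseˡ⇒inverseˡ; strictlyInverseʳ⇒inverseʳ)

    representative : Fin e → Fin n → Carrier
    representative a = proj₁ (IE.from a)

    coordinates : (Fin n → Carrier) → Fin e → Vector Carrier cΓ
    coordinates g a k = (g ÷ representative a) (root k)

    coordinates-cong : ∀ {g h a b} → (∀ i → g i ≈ h i) → a ≡ b →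
                       ∀ k → coordinates g a k ≈ coordinates h b k
    coordinates-cong g≋h ≡.refl k = ∙-congʳ (g≋h (root _))

    spread : Vector Carrier cΓ → Fin n → Carrier
    spread v i = v (component i)

    spread-edgeConstant : ∀ v → EdgeConstant (spread v)
    spread-edgeConstant v i j adj = reflexive (≡.cong v (IC.to-cong (adj ◅ ε)))

    decompose : RΓ G S Γ → Fin e × Vector Carrier cΓ
    decompose u = IE.to u , coordinates (proj₁ u) (IE.to u)

    recompose : Fin e × Vector Carrier cΓ → RΓ G S Γ
    recompose (a , v) = spread v ⋆ representative a
                      , ⋆-preserves-InR (spread-edgeConstant v) (proj₂ (IE.from a))

    decompose-cong : ∀ {u w} → u ≈ᴿ w → decompose u ≈ᴱ decompose w
    decompose-cong {u} {w} u≋w = class≡ , coordinates-cong u≋w class≡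
      where class≡ = IE.to-cong (≋⇒∼ u w u≋w)

    recompose-cong : ∀ {x y} → x ≈ᴱ y → recompose x ≈ᴿ recompose y
    recompose-cong (≡.refl , v≋w) i = ∙-congʳ (v≋w (component i))

    decompose∘recompose : ∀ x → decompose (recompose x) ≈ᴱ x
    decompose∘recompose (a , v) = class≡ , λ k → begin
      coordinates (spread v ⋆ representative a) (IE.to (recompose (a , v))) k
        ≈⟨ coordinates-cong {g = spread v ⋆ representative a} (λ _ → refl) class≡ k ⟩
      (spread v ⋆ representative a ÷ representative a) (root k)
        ≈⟨ ⋆÷-cancel (spread v) (representative a) (root k) ⟩
      v (component (root k))
        ≡⟨ ≡.cong v (IC.strictlyInverseˡ k) ⟩
      v k ∎
      where
      class≡ : IE.to (recompose (a , v)) ≡ a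
      class≡ = ≡.trans
        (IE.to-cong (⋆÷-edgeConstant (representative a) (spread-edgeConstant v)))
        (IE.strictlyInverseˡ a)

    recompose∘decompose : ∀ u → recompose (decompose u) ≈ᴿ u
    recompose∘decompose (g , g∈R) i = begin
      (g ÷ ρ) (root (component i)) ∙ ρ i
        ≈⟨ ∙-congʳ (edgeConstant⇒connectedConstant g∼ρ (IC.strictlyInverseʳ i)) ⟩
      (g ÷ ρ) i ∙ ρ i
        ≈⟨ ÷⋆-cancel g ρ i ⟩
      g i ∎
      where
      ρ = representative (IE.to (g , g∈R))
      g∼ρ : EdgeConstant (g ÷ ρ)
      g∼ρ = IsEquivalence.sym (∼-isEquivalence G S Γ) {IE.from (IE.to (g , g∈R))} {g , g∈R}
                              (IE.strictlyInverseʳ (g , g∈R))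

    decomposition : Inverse Rₛ Eₛ
    decomposition = record
      { to        = decompose
      ; from      = recompose
      ; to-cong   = decompose-cong
      ; from-cong = recompose-cong
      ; inverse   = strictlyInverseˡ⇒inverseˡ {f = decompose} {f⁻¹ = recompose}
                        decompose-cong decompose∘recompose
                  , strictlyInverseʳ⇒inverseʳ {f⁻¹ = recompose}
                        recompose-cong recompose∘decompose
      }

proposition3p1 : ∀ {c ℓ p : Level} (G : Group c ℓ) (N : ℕ)
    → HasCard (Group.setoid G) N
    → (n : ℕ) (S : Fin n → Pred (Group.Carrier G) p)
    → (∀ i {x y} → Group._≈_ G x y → S i x → S i y)
    → (∀ i → ∃ λ s → S i s)
    → (Γ : SimpleGraph n)
    → (cΓ r e : ℕ)
    → NumComponents Γ cΓ
    → HasCard (RSetoid G S Γ) r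
    → HasCard (ESetoid G S Γ) e
    → r ≡ e * N ^ cΓ
proposition3p1 G N IG n S _ _ Γ cΓ r e IC IR IE =
  HasCard-unique IR
    (HasCard-resp-Inverse (Decomposition.decomposition G S Γ IC IE)
      (HasCard-×ₛ (HasCard-Fin e) (HasCard-≋ (Group.setoid G) IG cΓ)))
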